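{- Let $Q$ be a strongly-connected starred quiver. For $a\in\mathrm{Arr}(Q)$ let $D_a$ be the torus-invariant Weil divisor of $Y(\mathcal F_Q)$ associated to the ray of $\mathcal F_Q$ spanned by $u_a$. A Weil divisor $\sum_a c_aD_a$ ($c_a\in\mathbb Z$) is Cartier if and only if $\sum_{a\in\pi}\varepsilon(a)c_a=0$ for every path $\pi\in\Pi(S)$, for every set $S=\{a\in\mathrm{Arr}(Q): M(a)=-1\}$ with $M$ a facet arrow-labeling of $Q$.
   Context: A starred quiver $Q$ has normal vertices $v_1,\dots,v_n$ ($n\ge1$), at least one starred vertex, and arrows $\mathrm{Arr}(Q)$ each going normal-to-normal, normal-to-starred or starred-to-normal; no loops, no repeated arrows, connected underlying graph. $Q$ is strongly-connected if after identifying all starred vertices into one there is an oriented path from any vertex to any other. For each arrow $a$ define $u_a\in\mathbb R^n$: $u_a=e_j-e_i$ if $a:v_i\to v_j$; $u_a=e_j$ if $a$ goes from a starred vertex to $v_j$; $u_a=-e_i$ if $a$ goes from $v_i$ to a starred vertex; $\mathrm{Root}(Q)=\mathrm{Conv}\{u_a\}$. $\mathcal F_Q$ is its face fan in $\mathbb R^n$ (lattice $\mathbb Z^n$) and $Y(\mathcal F_Q)$ the associated toric variety. A facet arrow-labeling is a map $M:\mathrm{Arr}(Q)\to\mathbb R_{\ge-1}$ such that (i) $\min M=-1$ and for every oriented path from a starred vertex to a starred vertex the labels sum to $0$; (ii) no other map satisfying (i) has set of $(-1)$-labeled arrows properly containing that of $M$. For $S\subseteq\mathrm{Arr}(Q)$,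 $\Pi(S)$ is the set of paths in the underlying undirected graph of $Q$ using only arrows from $S$ that are either closed or begin and end at starred vertices; for $a\in\pi$, $\varepsilon(a)=+1$ if $a$ is oriented along the traversal of $\pi$ and $-1$ otherwise. -}

module Defs where

open import Data.Nat using (ℕ; zero; suc; _≤_)
open import Data.Fin using (Fin; _≟_)
open import Relation.Nullary using (yes; no)
open import Data.Sum using (_⊎_; inj₁; inj₂)
open import Data.Unit using (⊤; tt)
open import Data.Empty using (⊥)
open import Data.Product using (_×_; Σ; ∃; ∃-syntax; _,_)
open import Relation.Nullary using (¬_)
open import Relation.Binary.PropositionalEquality using (_≡_; _≢_)
open import Data.Integer as ℤ using (ℤ)
open import Data.Rational as ℚ using (ℚ; 1ℚ; 0ℚ)

Vertex : ℕ → ℕ → Set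
Vertex n s = Fin n ⊎ Fin s

IsStarred : ∀ {n s} → Vertex n s → Set
IsStarred (inj₁ _) = ⊥
IsStarred (inj₂ _) = ⊤

-- Undirected walks in the underlying graph, using only arrows
-- satisfying the predicate P.  Each step records the arrow and whether it
-- is traversed along (fwd) or against (bwd) its orientation.
data UWalk {n s k : ℕ} (src tgt : Fin k → Vertex n s) (P : Fin k → Set)
     : Vertex n s → Vertex n s → Set where
  []  : ∀ {v} → UWalk src tgt P v v
  fwd : ∀ {w} (a : Fin k) → P a → UWalk src tgt P (tgt a) w → UWalk src tgt P (src a) w
  bwd : ∀ {w} (a : Fin k) → P a → UWalk src tgt P (src a) w → UWalk src tgt P (tgt a) w

data DWalk {k : ℕ} {V : Set} (src tgt : Fin k → V) : V → V → Set where
  []   : ∀ {v} → DWalk src tgt v v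
  step : ∀ {w} (a : Fin k) → DWalk src tgt (tgt a) w → DWalk src tgt (src a) w

collapse : ∀ {n s} → Vertex n s → Fin n ⊎ ⊤
collapse (inj₁ i) = inj₁ i
collapse (inj₂ _) = inj₂ tt

record StarredQuiver : Set where
  field
    n k s      : ℕ
    n≥1        : 1 ≤ n
    s≥1        : 1 ≤ s
    src tgt    : Fin k → Vertex n s
    noStarStar : ∀ a → ¬ (IsStarred (src a) × IsStarred (tgt a))
    noLoop     : ∀ a → src a ≢ tgt a
    noRepeat   : ∀ a b → src a ≡ src b → tgt a ≡ tgt b → a ≡ b
    connected  : ∀ v w → UWalk src tgt (λ _ → ⊤) v w

  Arr : Set
  Arr = Fin k

open StarredQuiver public

StronglyConnected : StarredQuiver → Set
StronglyConnected Q =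
  ∀ x y → DWalk (λ a → collapse (src Q a)) (λ a → collapse (tgt Q a)) x y

eᵥ : ∀ {n s} → Vertex n s → Fin n → ℤ
eᵥ (inj₁ i) j with i ≟ j
... | yes _ = ℤ.+ 1
... | no  _ = ℤ.+ 0
eᵥ (inj₂ _) j = ℤ.+ 0

-- u_a = e_target − e_source, where e of a starred vertex is 0
-- (this gives e_j − e_i, e_j, −e_i in the three cases)
u : (Q : StarredQuiver) → Arr Q → Fin (n Q) → ℤ
u Q a j = eᵥ (tgt Q a) j ℤ.- eᵥ (src Q a) j

sumℤ : ∀ {m} → (Fin m → ℤ) → ℤ
sumℤ {zero}  f = ℤ.+ 0
sumℤ {suc m} f = f Data.Fin.zero ℤ.+ sumℤ (λ i → f (Data.Fin.suc i))

sumℚ : ∀ {m} → (Fin m → ℚ) → ℚ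
sumℚ {zero}  f = 0ℚ
sumℚ {suc m} f = f Data.Fin.zero ℚ.+ sumℚ (λ i → f (Data.Fin.suc i))

toℚ : ℤ → ℚ
toℚ z = z ℚ./ 1

dotℤ : ∀ {m} → (Fin m → ℤ) → (Fin m → ℤ) → ℤ
dotℤ x y = sumℤ (λ i → x i ℤ.* y i)

dotℚ : ∀ {m} → (Fin m → ℚ) → (Fin m → ℤ) → ℚ
dotℚ x y = sumℚ (λ i → x i ℚ.* toℚ (y i))

-1ℚ : ℚ
-1ℚ = ℚ.- 1ℚ

-- A (nonempty proper) face of Root(Q) = Conv{u_a} is cut out by a
-- rational linear functional m with ⟨m,u_a⟩ ≥ −1 for all a and = −1 for
-- some a; its vertex set among the u_a is {a : ⟨m,u_a⟩ = −1}.
-- Facets are the inclusion-maximal such faces; the maximal cones of the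
-- face fan are the cones over the facets.

IsFaceFunctional : (Q : StarredQuiver) → (Fin (n Q) → ℚ) → Set
IsFaceFunctional Q m =
  (∀ a → -1ℚ ℚ.≤ dotℚ m (u Q a)) × (∃[ a ] dotℚ m (u Q a) ≡ -1ℚ)

IsFacetFunctional : (Q : StarredQuiver) → (Fin (n Q) → ℚ) → Set
IsFacetFunctional Q m =
  IsFaceFunctional Q m ×
  ¬ (∃[ m' ] (IsFaceFunctional Q m' ×
       (∀ a → dotℚ m (u Q a) ≡ -1ℚ → dotℚ m' (u Q a) ≡ -1ℚ) ×
       (∃[ a ] (dotℚ m' (u Q a) ≡ -1ℚ × dotℚ m (u Q a) ≢ -1ℚ))))

-- u_a lies in the maximal cone over the facet cut out by m
InCone : (Q : StarredQuiver) → (Fin (n Q) → ℚ) → Arr Q → Set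
InCone Q m a = dotℚ m (u Q a) ≡ -1ℚ

-- The torus-invariant Weil divisor Σ c_a D_a is Cartier iff on each maximal
-- cone σ it is given by a character: ∃ m_σ ∈ ℤ^n with ⟨m_σ,u_a⟩ = −c_a for
-- every ray generator u_a of σ  (Cox–Little–Schenck, Thm 4.2.8).
IsCartier : (Q : StarredQuiver) → (Arr Q → ℤ) → Set
IsCartier Q c =
  ∀ m → IsFacetFunctional Q m →
    ∃[ mσ ] (∀ a → InCone Q m a → dotℤ mσ (u Q a) ≡ ℤ.- c a)

dsum : ∀ {k} {V : Set} {src tgt : Fin k → V} → (Fin k → ℚ) →
       ∀ {v w} → DWalk src tgt v w → ℚ
dsum M []         = 0ℚ
dsum M (step a p) = M a ℚ.+ dsum M p

IsLabeling : (Q : StarredQuiver) → (Arr Q → ℚ) → Set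
IsLabeling Q M =
  (∀ a → -1ℚ ℚ.≤ M a) × (∃[ a ] M a ≡ -1ℚ) ×
  (∀ v w → IsStarred v → IsStarred w →
     (p : DWalk (src Q) (tgt Q) v w) → dsum M p ≡ 0ℚ)

IsFacetLabeling : (Q : StarredQuiver) → (Arr Q → ℚ) → Set
IsFacetLabeling Q M =
  IsLabeling Q M ×
  ¬ (∃[ M' ] (IsLabeling Q M' ×
       (∀ a → M a ≡ -1ℚ → M' a ≡ -1ℚ) ×
       (∃[ a ] (M' a ≡ -1ℚ × M a ≢ -1ℚ))))

usum : ∀ {n s k} {src tgt : Fin k → Vertex n s} {P : Fin k → Set} →
       (Fin k → ℤ) → ∀ {v w} → UWalk src tgt P v w → ℤ
usum c []            = ℤ.+ 0
usum c (fwd a _ p)   = c a ℤ.+ usum c p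
usum c (bwd a _ p)   = ℤ.- c a ℤ.+ usum c p

InΠ : (Q : StarredQuiver) (S : Arr Q → Set) {v w : Vertex (n Q) (s Q)} →
      UWalk (src Q) (tgt Q) S v w → Set
InΠ Q S {v} {w} π = (v ≡ w) ⊎ (IsStarred v × IsStarred w)

-- A functional m ∈ ℚⁿ labels each arrow by ⟨m, u_a⟩ = m(tgt a) − m(src a), where m is extended
-- by 0 to the starred vertices. These labels telescope to 0 along star-to-star paths, and by
-- strong connectivity every labeling with this property arises so: take m(v) to be the label sum
-- of an oriented path from the collapsed starred vertex to v. Hence facet functionals and facet
-- labelings correspond, the rays of a facet cone being the (−1)-labelled arrows S. On that cone
-- Σ c_a D_a is given by a character m_σ iff c is, on S, the coboundary of an integer function
-- h = −m_σ on the vertices vanishing at the starred ones. Such an h exists iff the signed c-sums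
-- over Π(S) vanish: one way by telescoping, the other by summing c along a spanning forest of S
-- rooted, where possible, at starred vertices.

module Submission where

open import Defs
open import Algebra.Bundles using (Ring)
open import Data.Empty using (⊥-elim)
open import Data.Fin as Fin using (Fin; zero; suc; punchIn)
open import Data.Fin.Properties using (punchInᵢ≢i)
open import Data.Integer as ℤ using (ℤ; +_; 0ℤ; 1ℤ)
import Data.Integer.Properties as ℤP
open import Data.Integer.Tactic.RingSolver using (solve-∀)
open import Data.List using (List; []; _∷_; allFin)
open import Data.List.Membership.Propositional using (_∈_)
open import Data.List.Membership.Propositional.Properties using (∈-allFin)
open import Data.List.Relation.Unary.Any using (here; there)
open import Data.Nat using (zero; suc)
open import Data.Product using (_×_; ∃-syntax; Σ-syntax; _,_; proj₂)
open import Data.Rational as ℚ using (ℚ; 0ℚ)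
import Data.Rational.Properties as ℚP
import Data.Rational.Solver
open import Data.Sum using (_⊎_; inj₁; inj₂)
import Data.Sum.Properties as Sum
open import Data.Unit using (⊤; tt)
open import Function using (_∘_; id)
open import Function.Bundles using (_⇔_; mk⇔)
open import Relation.Binary.PropositionalEquality
  using (_≡_; _≢_; refl; sym; trans; cong; cong₂; subst; module ≡-Reasoning)
open import Relation.Nullary using (Dec; yes; no; ¬_)
open import Relation.Nullary.Decidable using (_⊎-dec_; _×-dec_)
open import Relation.Unary using (Decidable; _⊆_)

-- Pairing with u_a

Bit : ℤ → Set
Bit z = z ≡ 0ℤ ⊎ z ≡ 1ℤ

eᵥ-bit : ∀ {n s} (v : Vertex n s) j → Bit (eᵥ v j)
eᵥ-bit (inj₁ i) j with i Fin.≟ j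
... | yes _ = inj₂ refl
... | no  _ = inj₁ refl
eᵥ-bit (inj₂ _) j = inj₁ refl

eᵥ-diagonal : ∀ {n s} (i : Fin n) → eᵥ {n} {s} (inj₁ i) i ≡ 1ℤ
eᵥ-diagonal i with i Fin.≟ i
... | yes _   = refl
... | no  i≢i = ⊥-elim (i≢i refl)

eᵥ-off-diagonal : ∀ {n s} {i j : Fin n} → j ≢ i → eᵥ {n} {s} (inj₁ i) j ≡ 0ℤ
eᵥ-off-diagonal {i = i} {j} j≢i with i Fin.≟ j
... | yes i≡j = ⊥-elim (j≢i (sym i≡j))
... | no  _   = refl

module Pairing {c ℓ} (R : Ring c ℓ) where
  open Ring R hiding (zero; refl)
    renaming (sym to ≈-sym; trans to ≈-trans; reflexive to ≈-reflexive)
  open import Algebra.Properties.CommutativeMonoid.Sum +-commutativeMonoid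
  open import Algebra.Properties.Ring R using (x[y-z]≈xy-xz)
  open import Algebra.Properties.AbelianGroup +-abelianGroup using (⁻¹-∙-comm)
  open import Algebra.Properties.Group +-group using (ε⁻¹≈ε)
  open import Relation.Binary.Reasoning.Setoid setoid

  sum-unique : (σ : ∀ {k} → (Fin k → Carrier) → Carrier) →
               (∀ f → σ {0} f ≈ 0#) → (∀ {k} f → σ {suc k} f ≈ f zero + σ (f ∘ suc)) →
               ∀ {k} (f : Fin k → Carrier) → σ f ≈ sum f
  sum-unique σ σ-zero σ-suc {zero}  f = σ-zero f
  sum-unique σ σ-zero σ-suc {suc k} f =
    ≈-trans (σ-suc f) (+-congˡ (sum-unique σ σ-zero σ-suc (f ∘ suc)))

  sum-neg : ∀ {k} (f : Fin k → Carrier) → sum (λ j → - f j) ≈ - sum f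
  sum-neg {zero}  f = ≈-sym ε⁻¹≈ε
  sum-neg {suc k} f = ≈-trans (+-congˡ (sum-neg (f ∘ suc))) (⁻¹-∙-comm (f zero) (sum (f ∘ suc)))

  sum-sub : ∀ {k} (f g : Fin k → Carrier) → sum (λ j → f j - g j) ≈ sum f - sum g
  sum-sub f g = ≈-trans (∑-distrib-+ f (λ j → - g j)) (+-congˡ (sum-neg g))

  sum-supported-at : ∀ {k} (i : Fin (suc k)) (f : Fin (suc k) → Carrier) →
                     (∀ j → j ≢ i → f j ≈ 0#) → sum f ≈ f i
  sum-supported-at {k} i f off = begin
    sum f                        ≈⟨ sum-remove f ⟩
    f i + sum (f ∘ punchIn i)
      ≈⟨ +-congˡ (sum-cong-≋ (λ j → off (punchIn i j) (punchInᵢ≢i i j))) ⟩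
    f i + sum {k} (λ _ → 0#)     ≈⟨ +-congˡ (sum-replicate-zero k) ⟩
    f i + 0#                     ≈⟨ +-identityʳ (f i) ⟩
    f i                          ∎

  height : ∀ {n} → (Fin n → Carrier) → Fin n ⊎ ⊤ → Carrier
  height m (inj₁ i) = m i
  height m (inj₂ _) = 0#

  -- ι only has to respect differences of bits, the only integers subtracted in e_w − e_v.
  module _ (ι : ℤ → Carrier) (ι-0 : ι 0ℤ ≈ 0#) (ι-1 : ι 1ℤ ≈ 1#)
           (ι-sub : ∀ {p q} → Bit p → Bit q → ι (p ℤ.- q) ≈ ι p - ι q) where

    pair : ∀ {n} → (Fin n → Carrier) → (Fin n → ℤ) → Carrier
    pair m y = sum (λ j → m j * ι (y j))

    pair-eᵥ : ∀ {n s} (m : Fin n → Carrier) (v : Vertex n s) →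
              pair m (eᵥ v) ≈ height m (collapse v)
    pair-eᵥ {suc n} {s} m (inj₁ i) = begin
      pair m (eᵥ {s = s} (inj₁ i))     ≈⟨ sum-supported-at i _ off ⟩
      m i * ι (eᵥ {s = s} (inj₁ i) i)  ≈⟨ *-congˡ (≈-reflexive (cong ι (eᵥ-diagonal {s = s} i))) ⟩
      m i * ι 1ℤ                       ≈⟨ *-congˡ ι-1 ⟩
      m i * 1#                         ≈⟨ *-identityʳ (m i) ⟩
      m i                              ∎
      where
      off : ∀ j → j ≢ i → m j * ι (eᵥ {s = s} (inj₁ i) j) ≈ 0#
      off j j≢i = ≈-trans (*-congˡ (≈-trans (≈-reflexive (cong ι (eᵥ-off-diagonal {s = s} j≢i)))
                                            ι-0))
                          (zeroʳ (m j))
    pair-eᵥ {n} m (inj₂ _) = begin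
      sum (λ j → m j * ι 0ℤ)  ≈⟨ sum-cong-≋ (λ j → ≈-trans (*-congˡ ι-0) (zeroʳ (m j))) ⟩
      sum {n} (λ _ → 0#)      ≈⟨ sum-replicate-zero n ⟩
      0#                      ∎

    pair-eᵥ-diff : ∀ {n s} (m : Fin n → Carrier) (w v : Vertex n s) →
                   pair m (λ j → eᵥ w j ℤ.- eᵥ v j) ≈ height m (collapse w) - height m (collapse v)
    pair-eᵥ-diff m w v = begin
      sum (λ j → m j * ι (eᵥ w j ℤ.- eᵥ v j))
        ≈⟨ sum-cong-≋ (λ j → ≈-trans (*-congˡ (ι-sub (eᵥ-bit w j) (eᵥ-bit v j)))
                                      (x[y-z]≈xy-xz (m j) _ _)) ⟩
      sum (λ j → m j * ι (eᵥ w j) - m j * ι (eᵥ v j))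
        ≈⟨ sum-sub (λ j → m j * ι (eᵥ w j)) (λ j → m j * ι (eᵥ v j)) ⟩
      pair m (eᵥ w) - pair m (eᵥ v)
        ≈⟨ +-cong (pair-eᵥ m w) (-‿cong (pair-eᵥ m v)) ⟩
      height m (collapse w) - height m (collapse v) ∎

module ℤ-Pairing = Pairing ℤP.+-*-ring
module ℚ-Pairing = Pairing ℚP.+-*-ring
open ℤ-Pairing using () renaming (height to heightℤ)
open ℚ-Pairing using () renaming (height to heightℚ)

toℚ-sub : ∀ {p q} → Bit p → Bit q → toℚ (p ℤ.- q) ≡ toℚ p ℚ.- toℚ q
toℚ-sub (inj₁ refl) (inj₁ refl) = refl
toℚ-sub (inj₁ refl) (inj₂ refl) = refl
toℚ-sub (inj₂ refl) (inj₁ refl) = refl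
toℚ-sub (inj₂ refl) (inj₂ refl) = refl

dotℤ-u : (Q : StarredQuiver) (m : Fin (n Q) → ℤ) (a : Arr Q) →
         dotℤ m (u Q a) ≡ heightℤ m (collapse (tgt Q a)) ℤ.- heightℤ m (collapse (src Q a))
dotℤ-u Q m a =
  trans (ℤ-Pairing.sum-unique sumℤ (λ _ → refl) (λ _ → refl) (λ j → m j ℤ.* u Q a j))
        (ℤ-Pairing.pair-eᵥ-diff id refl refl (λ _ _ → refl) m (tgt Q a) (src Q a))

dotℚ-u : (Q : StarredQuiver) (m : Fin (n Q) → ℚ) (a : Arr Q) →
         dotℚ m (u Q a) ≡ heightℚ m (collapse (tgt Q a)) ℚ.- heightℚ m (collapse (src Q a))
dotℚ-u Q m a =
  trans (ℚ-Pairing.sum-unique sumℚ (λ _ → refl) (λ _ → refl) (λ j → m j ℚ.* toℚ (u Q a j)))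
        (ℚ-Pairing.pair-eᵥ-diff toℚ refl refl toℚ-sub m (tgt Q a) (src Q a))

infix 4 _≈★_
_≈★_ : ∀ {n s} → Vertex n s → Vertex n s → Set
v ≈★ w = v ≡ w ⊎ (IsStarred v × IsStarred w)

isStarred? : ∀ {n s} (v : Vertex n s) → Dec (IsStarred v)
isStarred? (inj₁ _) = no λ ()
isStarred? (inj₂ _) = yes tt

_≟V_ : ∀ {n s} (v w : Vertex n s) → Dec (v ≡ w)
_≟V_ = Sum.≡-dec Fin._≟_ Fin._≟_

_≈★?_ : ∀ {n s} (v w : Vertex n s) → Dec (v ≈★ w)
v ≈★? w = (v ≟V w) ⊎-dec (isStarred? v ×-dec isStarred? w)

collapse-≡⇒≈★ : ∀ {n s} {v w : Vertex n s} → collapse v ≡ collapse w → v ≈★ w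
collapse-≡⇒≈★ {v = inj₁ _} {inj₁ _} refl = inj₁ refl
collapse-≡⇒≈★ {v = inj₂ _} {inj₂ _} _    = inj₂ (tt , tt)

collapse-≡★ : ∀ {n s} {v : Vertex n s} → collapse v ≡ inj₂ tt → IsStarred v
collapse-≡★ {v = inj₂ _} _ = tt

module _ {k} {V : Set} {sr tg : Fin k → V} where

  _++D_ : ∀ {x y z} → DWalk sr tg x y → DWalk sr tg y z → DWalk sr tg x z
  []       ++D q = q
  step a p ++D q = step a (p ++D q)

  dsum-++ : (M : Fin k → ℚ) {x y z : V} (p : DWalk sr tg x y) (q : DWalk sr tg y z) →
            dsum M (p ++D q) ≡ dsum M p ℚ.+ dsum M q
  dsum-++ M []         q = sym (ℚP.+-identityˡ (dsum M q))
  dsum-++ M (step a p) q =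
    trans (cong (M a ℚ.+_) (dsum-++ M p q)) (sym (ℚP.+-assoc (M a) (dsum M p) (dsum M q)))

  dsum-snoc : (M : Fin k → ℚ) (a : Fin k) {x : V} (p : DWalk sr tg x (sr a)) →
              dsum M (p ++D step a []) ≡ dsum M p ℚ.+ M a
  dsum-snoc M a p = trans (dsum-++ M p (step a [])) (cong (dsum M p ℚ.+_) (ℚP.+-identityʳ (M a)))

  dsum-telescopes : (M : Fin k → ℚ) (h : V → ℚ) → (∀ a → M a ≡ h (tg a) ℚ.- h (sr a)) →
                    ∀ {x y} (p : DWalk sr tg x y) → dsum M p ≡ h y ℚ.- h x
  dsum-telescopes M h dh {x} [] = sym (ℚP.+-inverseʳ (h x))
  dsum-telescopes M h dh {y = y} (step a p) = begin
    M a ℚ.+ dsum M p                                ≡⟨ cong₂ ℚ._+_ (dh a) (dsum-telescopes M h dh p) ⟩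
    (h (tg a) ℚ.- h (sr a)) ℚ.+ (h y ℚ.- h (tg a))  ≡⟨ telescope (h (sr a)) (h (tg a)) (h y) ⟩
    h y ℚ.- h (sr a)                                ∎
    where
    open ≡-Reasoning
    open Data.Rational.Solver.+-*-Solver
    telescope : ∀ x y z → (y ℚ.- x) ℚ.+ (z ℚ.- y) ≡ z ℚ.- x
    telescope = solve 3 (λ x y z → (y :- x) :+ (z :- y) := z :- x) refl

module _ {n s k} {sr tg : Fin k → Vertex n s} {P : Fin k → Set} where

  _++U_ : ∀ {x y z} → UWalk sr tg P x y → UWalk sr tg P y z → UWalk sr tg P x z
  []         ++U q = q
  fwd a pa p ++U q = fwd a pa (p ++U q)
  bwd a pa p ++U q = bwd a pa (p ++U q)

  reverse : ∀ {x y} → UWalk sr tg P x y → UWalk sr tg P y x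
  reverse []           = []
  reverse (fwd a pa p) = reverse p ++U bwd a pa []
  reverse (bwd a pa p) = reverse p ++U fwd a pa []

  usum-++ : (c : Fin k → ℤ) {x y z : Vertex n s} (p : UWalk sr tg P x y) (q : UWalk sr tg P y z) →
            usum c (p ++U q) ≡ usum c p ℤ.+ usum c q
  usum-++ c []          q = sym (ℤP.+-identityˡ (usum c q))
  usum-++ c (fwd a _ p) q =
    trans (cong (ℤ._+_ (c a)) (usum-++ c p q)) (sym (ℤP.+-assoc (c a) (usum c p) (usum c q)))
  usum-++ c (bwd a _ p) q =
    trans (cong (ℤ._+_ (ℤ.- c a)) (usum-++ c p q)) (sym (ℤP.+-assoc (ℤ.- c a) (usum c p) (usum c q)))

  usum-reverse : (c : Fin k → ℤ) {x y : Vertex n s} (p : UWalk sr tg P x y) →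
                 usum c (reverse p) ≡ ℤ.- usum c p
  usum-reverse c []           = refl
  usum-reverse c (fwd a pa p) = begin
    usum c (reverse p ++U bwd a pa [])       ≡⟨ usum-++ c (reverse p) (bwd a pa []) ⟩
    usum c (reverse p) ℤ.+ (ℤ.- c a ℤ.+ 0ℤ)  ≡⟨ cong (ℤ._+ (ℤ.- c a ℤ.+ 0ℤ)) (usum-reverse c p) ⟩
    ℤ.- usum c p ℤ.+ (ℤ.- c a ℤ.+ 0ℤ)        ≡⟨ rearrange (c a) (usum c p) ⟩
    ℤ.- (c a ℤ.+ usum c p)                   ∎
    where
    open ≡-Reasoning
    rearrange : ∀ x y → ℤ.- y ℤ.+ (ℤ.- x ℤ.+ 0ℤ) ≡ ℤ.- (x ℤ.+ y)
    rearrange = solve-∀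
  usum-reverse c (bwd a pa p) = begin
    usum c (reverse p ++U fwd a pa [])   ≡⟨ usum-++ c (reverse p) (fwd a pa []) ⟩
    usum c (reverse p) ℤ.+ (c a ℤ.+ 0ℤ)  ≡⟨ cong (ℤ._+ (c a ℤ.+ 0ℤ)) (usum-reverse c p) ⟩
    ℤ.- usum c p ℤ.+ (c a ℤ.+ 0ℤ)        ≡⟨ rearrange (c a) (usum c p) ⟩
    ℤ.- (ℤ.- c a ℤ.+ usum c p)           ∎
    where
    open ≡-Reasoning
    rearrange : ∀ x y → ℤ.- y ℤ.+ (x ℤ.+ 0ℤ) ≡ ℤ.- (ℤ.- x ℤ.+ y)
    rearrange = solve-∀

  usum-telescopes : (c : Fin k → ℤ) (h : Vertex n s → ℤ) →
                    (∀ a → P a → c a ≡ h (tg a) ℤ.- h (sr a)) →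
                    ∀ {x y} (p : UWalk sr tg P x y) → usum c p ≡ h y ℤ.- h x
  usum-telescopes c h dh {x} [] = sym (ℤP.+-inverseʳ (h x))
  usum-telescopes c h dh {y = y} (fwd a pa p) =
    trans (cong₂ ℤ._+_ (dh a pa) (usum-telescopes c h dh p))
          (telescope (h (sr a)) (h (tg a)) (h y))
    where
    telescope : ∀ x y z → (y ℤ.- x) ℤ.+ (z ℤ.- y) ≡ z ℤ.- x
    telescope = solve-∀
  usum-telescopes c h dh {y = y} (bwd a pa p) =
    trans (cong₂ ℤ._+_ (cong ℤ.-_ (dh a pa)) (usum-telescopes c h dh p))
          (telescope (h (sr a)) (h (tg a)) (h y))
    where
    telescope : ∀ x y z → ℤ.- (y ℤ.- x) ℤ.+ (z ℤ.- x) ≡ z ℤ.- y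
    telescope = solve-∀

-- Facet functionals and facet labelings

module _ (Q : StarredQuiver) where

  private
    ★ : Fin (n Q) ⊎ ⊤
    ★ = inj₂ tt

    Walk = DWalk (src Q) (tgt Q)
    CollapsedWalk = DWalk (collapse ∘ src Q) (collapse ∘ tgt Q)

    arrow : (a : Arr Q) → Walk (src Q a) (tgt Q a)
    arrow a = step a []

  labelingOf : (Fin (n Q) → ℚ) → Arr Q → ℚ
  labelingOf m a = dotℚ m (u Q a)

  StarPathSumsVanish : (Arr Q → ℚ) → Set
  StarPathSumsVanish M = ∀ v w → IsStarred v → IsStarred w → (p : Walk v w) → dsum M p ≡ 0ℚ

  labelingOf-starPathSumsVanish : (m : Fin (n Q) → ℚ) → StarPathSumsVanish (labelingOf m)
  labelingOf-starPathSumsVanish m (inj₂ _) (inj₂ _) _ _ =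
    dsum-telescopes (labelingOf m) (heightℚ m ∘ collapse) (dotℚ-u Q m)

  module _ {M : Arr Q → ℚ} (vanish : StarPathSumsVanish M) where

    -- q is a genuine walk from a starred vertex; each time p passes through the collapsed
    -- starred vertex, the accumulated sum is 0 by `vanish` and the walk restarts there.
    collapsedWalk-sum : ∀ {x} (p : CollapsedWalk x ★) {s₀ v} → IsStarred s₀ → (q : Walk s₀ v) →
                        collapse v ≡ x → dsum M q ℚ.+ dsum M p ≡ 0ℚ
    collapsedWalk-sum [] {s₀} {v} s₀★ q v↦★ =
      trans (ℚP.+-identityʳ (dsum M q)) (vanish s₀ v s₀★ (collapse-≡★ v↦★) q)
    collapsedWalk-sum (step a p) {s₀} {v} s₀★ q v↦src with collapse-≡⇒≈★ {w = src Q a} v↦src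
    ... | inj₁ refl = begin
      dsum M q ℚ.+ (M a ℚ.+ dsum M p)    ≡⟨ ℚP.+-assoc (dsum M q) (M a) (dsum M p) ⟨
      (dsum M q ℚ.+ M a) ℚ.+ dsum M p    ≡⟨ cong (ℚ._+ dsum M p) (dsum-snoc M a q) ⟨
      dsum M (q ++D arrow a) ℚ.+ dsum M p ≡⟨ collapsedWalk-sum p s₀★ (q ++D arrow a) refl ⟩
      0ℚ                                 ∎
      where open ≡-Reasoning
    ... | inj₂ (v★ , src★) = begin
      dsum M q ℚ.+ (M a ℚ.+ dsum M p)    ≡⟨ cong (ℚ._+ (M a ℚ.+ dsum M p)) (vanish s₀ v s₀★ v★ q) ⟩
      0ℚ ℚ.+ (M a ℚ.+ dsum M p)          ≡⟨ ℚP.+-identityˡ (M a ℚ.+ dsum M p) ⟩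
      M a ℚ.+ dsum M p                   ≡⟨ cong (ℚ._+ dsum M p) (ℚP.+-identityʳ (M a)) ⟨
      dsum M (arrow a) ℚ.+ dsum M p      ≡⟨ collapsedWalk-sum p src★ (arrow a) refl ⟩
      0ℚ                                 ∎
      where open ≡-Reasoning

    closedCollapsedWalk-sum : (p : CollapsedWalk ★ ★) → dsum M p ≡ 0ℚ
    closedCollapsedWalk-sum p =
      trans (sym (ℚP.+-identityˡ (dsum M p)))
            (collapsedWalk-sum p {inj₂ (Fin.fromℕ< (s≥1 Q))} tt [] refl)

    stronglyConnected⇒functional : StronglyConnected Q → ∃[ m ] (∀ a → labelingOf m a ≡ M a)
    stronglyConnected⇒functional sc = m , labelingOf-m
      where
      open ≡-Reasoning

      φ : Fin (n Q) ⊎ ⊤ → ℚ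
      φ x = dsum M (sc ★ x)

      m : Fin (n Q) → ℚ
      m i = φ (inj₁ i)

      height-m : ∀ x → heightℚ m x ≡ φ x
      height-m (inj₁ i) = refl
      height-m (inj₂ _) = sym (closedCollapsedWalk-sum (sc ★ ★))

      cancel : ∀ x y z b → x ℚ.+ (y ℚ.+ b) ≡ 0ℚ → z ℚ.+ b ≡ 0ℚ → y ≡ z ℚ.- x
      cancel x y z b e₁ e₂ = begin
        y                                                ≡⟨ rearrange x y z b ⟩
        (z ℚ.- x) ℚ.+ ((x ℚ.+ (y ℚ.+ b)) ℚ.- (z ℚ.+ b))  ≡⟨ cong₂ (λ e f → (z ℚ.- x) ℚ.+ (e ℚ.- f)) e₁ e₂ ⟩
        (z ℚ.- x) ℚ.+ (0ℚ ℚ.- 0ℚ)                        ≡⟨ ℚP.+-identityʳ (z ℚ.- x) ⟩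
        z ℚ.- x                                          ∎
        where
        open Data.Rational.Solver.+-*-Solver
        rearrange : ∀ x y z b → y ≡ (z ℚ.- x) ℚ.+ ((x ℚ.+ (y ℚ.+ b)) ℚ.- (z ℚ.+ b))
        rearrange = solve 4 (λ x y z b → y := (z :- x) :+ ((x :+ (y :+ b)) :- (z :+ b))) refl

      -- Close up ★ → src a → tgt a → ★ and ★ → tgt a → ★ with the same return walk.
      M≡Δφ : ∀ a → M a ≡ φ (collapse (tgt Q a)) ℚ.- φ (collapse (src Q a))
      M≡Δφ a = cancel (φ (collapse (src Q a))) (M a) (φ (collapse (tgt Q a))) (dsum M back)
        (trans (sym (dsum-++ M (sc ★ _) (step a back)))
               (closedCollapsedWalk-sum (sc ★ _ ++D step a back)))
        (trans (sym (dsum-++ M (sc ★ _) back)) (closedCollapsedWalk-sum (sc ★ _ ++D back)))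
        where
        back : CollapsedWalk (collapse (tgt Q a)) ★
        back = sc _ ★

      labelingOf-m : ∀ a → labelingOf m a ≡ M a
      labelingOf-m a = begin
        labelingOf m a
          ≡⟨ dotℚ-u Q m a ⟩
        heightℚ m (collapse (tgt Q a)) ℚ.- heightℚ m (collapse (src Q a))
          ≡⟨ cong₂ ℚ._-_ (height-m (collapse (tgt Q a))) (height-m (collapse (src Q a))) ⟩
        φ (collapse (tgt Q a)) ℚ.- φ (collapse (src Q a))
          ≡⟨ M≡Δφ a ⟨
        M a ∎

  face⇒labeling : ∀ m → IsFaceFunctional Q m → IsLabeling Q (labelingOf m)
  face⇒labeling m (≥-1 , attained) = ≥-1 , attained , labelingOf-starPathSumsVanish m

  labeling⇒face : ∀ m {M} → (∀ a → labelingOf m a ≡ M a) → IsLabeling Q M → IsFaceFunctional Q m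
  labeling⇒face m m≗M (≥-1 , (a , Ma≡-1) , _) =
    (λ b → subst (-1ℚ ℚ.≤_) (sym (m≗M b)) (≥-1 b)) , (a , trans (m≗M a) Ma≡-1)

  facetFunctional⇒facetLabeling : StronglyConnected Q → ∀ m → IsFacetFunctional Q m →
                                  IsFacetLabeling Q (labelingOf m)
  facetFunctional⇒facetLabeling sc m (face , maximal) = face⇒labeling m face , λ where
    (M′ , labeling′ , larger , (a , M′a≡-1 , ma≢-1)) →
      let m′ , m′≗M′ = stronglyConnected⇒functional (proj₂ (proj₂ labeling′)) sc
      in maximal (m′ , labeling⇒face m′ m′≗M′ labeling′ ,
                  (λ b M′b≡-1 → trans (m′≗M′ b) (larger b M′b≡-1)) ,
                  (a , trans (m′≗M′ a) M′a≡-1 , ma≢-1))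

  facetLabeling⇒facetFunctional : StronglyConnected Q → ∀ {M} → IsFacetLabeling Q M →
                                  ∃[ m ] (IsFacetFunctional Q m × (∀ a → labelingOf m a ≡ M a))
  facetLabeling⇒facetFunctional sc (labeling , maximal) =
    let m , m≗M = stronglyConnected⇒functional (proj₂ (proj₂ labeling)) sc
    in m , (labeling⇒face m m≗M labeling , λ where
             (m′ , face′ , larger , (a , m′a≡-1 , ma≢-1)) →
               maximal (labelingOf m′ , face⇒labeling m′ face′ ,
                        (λ b Mb≡-1 → larger b (trans (m≗M b) Mb≡-1)) ,
                        (a , m′a≡-1 , λ Ma≡-1 → ma≢-1 (trans (m≗M a) Ma≡-1)))) ,
           m≗M

-- Characters and potentials

module _ (Q : StarredQuiver) where

  HasCharacterOn : (Arr Q → Set) → (Arr Q → ℤ) → Set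
  HasCharacterOn P c = ∃[ mσ ] (∀ a → P a → dotℤ mσ (u Q a) ≡ ℤ.- c a)

  HasPotentialOn : (Arr Q → Set) → (Arr Q → ℤ) → Set
  HasPotentialOn P c =
    Σ[ h ∈ (Vertex (n Q) (s Q) → ℤ) ]
      ((∀ z → IsStarred z → h z ≡ 0ℤ) × (∀ a → P a → c a ≡ h (tgt Q a) ℤ.- h (src Q a)))

  IsClosedOn : (Arr Q → Set) → (Arr Q → ℤ) → Set
  IsClosedOn P c = ∀ v w (π : UWalk (src Q) (tgt Q) P v w) → InΠ Q P π → usum c π ≡ 0ℤ

  module _ {P : Arr Q → Set} {c : Arr Q → ℤ} where
    open ≡-Reasoning

    character⇒potential : HasCharacterOn P c → HasPotentialOn P c
    character⇒potential (mσ , character) = h , (λ { (inj₂ _) _ → refl }) , dh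
      where
      H h : Vertex (n Q) (s Q) → ℤ
      H v = heightℤ mσ (collapse v)
      h v = ℤ.- H v

      dh : ∀ a → P a → c a ≡ h (tgt Q a) ℤ.- h (src Q a)
      dh a pa = begin
        c a                                ≡⟨ ℤP.neg-involutive (c a) ⟨
        ℤ.- (ℤ.- c a)                      ≡⟨ cong ℤ.-_ (trans (sym (character a pa)) (dotℤ-u Q mσ a)) ⟩
        ℤ.- (H (tgt Q a) ℤ.- H (src Q a))  ≡⟨ neg-sub (H (tgt Q a)) (H (src Q a)) ⟩
        h (tgt Q a) ℤ.- h (src Q a)        ∎
        where
        neg-sub : ∀ x y → ℤ.- (x ℤ.- y) ≡ ℤ.- x ℤ.- ℤ.- y
        neg-sub = solve-∀

    potential⇒character : HasPotentialOn P c → HasCharacterOn P c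
    potential⇒character (h , h★≡0 , dh) = mσ , character
      where
      mσ : Fin (n Q) → ℤ
      mσ i = ℤ.- h (inj₁ i)

      height-mσ : ∀ v → heightℤ mσ (collapse v) ≡ ℤ.- h v
      height-mσ (inj₁ _) = refl
      height-mσ (inj₂ j) = sym (cong ℤ.-_ (h★≡0 (inj₂ j) tt))

      character : ∀ a → P a → dotℤ mσ (u Q a) ≡ ℤ.- c a
      character a pa = begin
        dotℤ mσ (u Q a)
          ≡⟨ dotℤ-u Q mσ a ⟩
        heightℤ mσ (collapse (tgt Q a)) ℤ.- heightℤ mσ (collapse (src Q a))
          ≡⟨ cong₂ ℤ._-_ (height-mσ (tgt Q a)) (height-mσ (src Q a)) ⟩
        ℤ.- h (tgt Q a) ℤ.- ℤ.- h (src Q a)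
          ≡⟨ neg-sub (h (tgt Q a)) (h (src Q a)) ⟨
        ℤ.- (h (tgt Q a) ℤ.- h (src Q a))
          ≡⟨ cong ℤ.-_ (dh a pa) ⟨
        ℤ.- c a ∎
        where
        neg-sub : ∀ x y → ℤ.- (x ℤ.- y) ≡ ℤ.- x ℤ.- ℤ.- y
        neg-sub = solve-∀

    potential⇒closed : HasPotentialOn P c → IsClosedOn P c
    potential⇒closed (h , h★≡0 , dh) v w π v≈★w = begin
      usum c π      ≡⟨ usum-telescopes c h dh π ⟩
      h w ℤ.- h v   ≡⟨ ends v≈★w ⟩
      0ℤ            ∎
      where
      ends : v ≈★ w → h w ℤ.- h v ≡ 0ℤ
      ends (inj₁ refl)      = ℤP.+-inverseʳ (h v)
      ends (inj₂ (v★ , w★)) = cong₂ ℤ._-_ (h★≡0 w w★) (h★≡0 v v★)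

  potential-mono : ∀ {P P′ c} → P′ ⊆ P → HasPotentialOn P c → HasPotentialOn P′ c
  potential-mono P′⊆P (h , h★≡0 , dh) = h , h★≡0 , λ a → dh a ∘ P′⊆P

-- Spanning forests of the subquiver of arrows satisfying P

module SpanningForest (Q : StarredQuiver) {P : Arr Q → Set} (P? : Decidable P) where

  private
    V = Vertex (n Q) (s Q)
    Walk = UWalk (src Q) (tgt Q) P

  -- A component through starred vertices may keep several starred roots, hence ≈★ in `joined`.
  record Forest (L : List (Arr Q)) : Set where
    field
      root   : V → V
      branch : ∀ z → Walk (root z) z
      root★  : ∀ z → IsStarred z → IsStarred (root z)
      joined : ∀ a → a ∈ L → P a → root (src Q a) ≈★ root (tgt Q a)

  open Forest public

  bridge : ∀ {L} (F : Forest L) a → P a → Walk (root F (src Q a)) (root F (tgt Q a))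
  bridge F a pa = branch F (src Q a) ++U fwd a pa (reverse (branch F (tgt Q a)))

  module Redirect (r t : V) (r-normal : ¬ IsStarred r) where

    redirect : ∀ {v} → Dec (v ≡ r) → V
    redirect (yes _)    = t
    redirect {v} (no _) = v

    redirect-★ : ∀ {v} → IsStarred v → (d : Dec (v ≡ r)) → IsStarred (redirect d)
    redirect-★ v★ (yes refl) = ⊥-elim (r-normal v★)
    redirect-★ v★ (no _)     = v★

    redirect-≈★ : ∀ {x y} → x ≈★ y → redirect (x ≟V r) ≈★ redirect (y ≟V r)
    redirect-≈★ (inj₁ refl)      = inj₁ refl
    redirect-≈★ (inj₂ (x★ , y★)) = inj₂ (redirect-★ x★ _ , redirect-★ y★ _)

    redirect-onto : ∀ {v} (d : Dec (v ≡ r)) → v ≡ r ⊎ v ≡ t → redirect d ≡ t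
    redirect-onto (yes _)  _          = refl
    redirect-onto (no v≢r) (inj₁ v≡r) = ⊥-elim (v≢r v≡r)
    redirect-onto (no _)   (inj₂ v≡t) = v≡t

  merge : ∀ {L} (F : Forest L) (r t : V) → ¬ IsStarred r → Walk t r → ∀ a →
          root F (src Q a) ≡ r ⊎ root F (src Q a) ≡ t → root F (tgt Q a) ≡ r ⊎ root F (tgt Q a) ≡ t →
          Forest (a ∷ L)
  merge F r t r-normal link a src-end tgt-end = record
    { root   = λ z → redirect (root F z ≟V r)
    ; branch = λ z → branch′ z (root F z ≟V r)
    ; root★  = λ z z★ → redirect-★ (root★ F z z★) _
    ; joined = λ where
        b (here refl) _ → inj₁ (trans (redirect-onto _ src-end) (sym (redirect-onto _ tgt-end)))
        b (there b∈L) pb → redirect-≈★ (joined F b b∈L pb)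
    }
    where
    open Redirect r t r-normal
    branch′ : ∀ z (d : Dec (root F z ≡ r)) → Walk (redirect d) z
    branch′ z (yes refl) = link ++U branch F z
    branch′ z (no _)     = branch F z

  keep : ∀ {L} (F : Forest L) a → (P a → root F (src Q a) ≈★ root F (tgt Q a)) → Forest (a ∷ L)
  keep F a joined-a = record
    { root   = root F
    ; branch = branch F
    ; root★  = root★ F
    ; joined = λ where
        b (here refl) pb → joined-a pb
        b (there b∈L) pb → joined F b b∈L pb
    }

  extend : ∀ {L} a → Forest L → Forest (a ∷ L)
  extend a F with P? a
  ... | no ¬pa = keep F a (⊥-elim ∘ ¬pa)
  ... | yes pa with root F (src Q a) ≈★? root F (tgt Q a)
  ...   | yes joined-a = keep F a (λ _ → joined-a)
  ...   | no ¬joined with isStarred? (root F (tgt Q a))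
  ...     | no y-normal = merge F (root F (tgt Q a)) (root F (src Q a)) y-normal (bridge F a pa) a
                                (inj₂ refl) (inj₁ refl)
  ...     | yes y★      = merge F (root F (src Q a)) (root F (tgt Q a)) (λ x★ → ¬joined (inj₂ (x★ , y★)))
                                (reverse (bridge F a pa)) a (inj₁ refl) (inj₂ refl)

  forest : ∀ L → Forest L
  forest []      = record { root = id ; branch = λ _ → [] ; root★ = λ _ z★ → z★ ; joined = λ _ () }
  forest (a ∷ L) = extend a (forest L)

closed⇒potential : (Q : StarredQuiver) {P : Arr Q → Set} → Decidable P → ∀ {c} →
                   IsClosedOn Q P c → HasPotentialOn Q P c
closed⇒potential Q {P} P? {c} closed = h , h★≡0 , dh
  where
  open SpanningForest Q P?

  F : Forest (allFin (k Q))
  F = forest (allFin (k Q))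

  h : Vertex (n Q) (s Q) → ℤ
  h z = usum c (branch F z)

  h★≡0 : ∀ z → IsStarred z → h z ≡ 0ℤ
  h★≡0 z z★ = closed _ _ (branch F z) (inj₂ (root★ F z z★ , z★))

  dh : ∀ a → P a → c a ≡ h (tgt Q a) ℤ.- h (src Q a)
  dh a pa = solve-for-c (h (src Q a)) (c a) (h (tgt Q a)) (begin
    h (src Q a) ℤ.+ (c a ℤ.+ ℤ.- h (tgt Q a))
      ≡⟨ cong (λ z → h (src Q a) ℤ.+ (c a ℤ.+ z)) (usum-reverse c (branch F (tgt Q a))) ⟨
    h (src Q a) ℤ.+ usum c (fwd a pa (reverse (branch F (tgt Q a))))
      ≡⟨ usum-++ c (branch F (src Q a)) _ ⟨
    usum c (bridge F a pa)
      ≡⟨ closed _ _ (bridge F a pa) (joined F a (∈-allFin a) pa) ⟩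
    0ℤ ∎)
    where
    open ≡-Reasoning
    solve-for-c : ∀ x c y → x ℤ.+ (c ℤ.+ ℤ.- y) ≡ 0ℤ → c ≡ y ℤ.- x
    solve-for-c x c y e = begin
      c                                    ≡⟨ rearrange x c y ⟩
      (y ℤ.- x) ℤ.+ (x ℤ.+ (c ℤ.+ ℤ.- y))  ≡⟨ cong (ℤ._+_ (y ℤ.- x)) e ⟩
      (y ℤ.- x) ℤ.+ 0ℤ                     ≡⟨ ℤP.+-identityʳ (y ℤ.- x) ⟩
      y ℤ.- x                              ∎
      where
      rearrange : ∀ x c y → c ≡ (y ℤ.- x) ℤ.+ (x ℤ.+ (c ℤ.+ ℤ.- y))
      rearrange = solve-∀

proposition5p10 : (Q : StarredQuiver) → StronglyConnected Q → (c : Arr Q → ℤ) →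
    IsCartier Q c ⇔
      (∀ (M : Arr Q → ℚ) → IsFacetLabeling Q M →
        ∀ v w (π : UWalk (src Q) (tgt Q) (λ a → M a ≡ -1ℚ) v w) →
          InΠ Q (λ a → M a ≡ -1ℚ) π → usum c π ≡ + 0)
proposition5p10 Q sc c = mk⇔ cartier⇒closed closed⇒cartier
  where
  cartier⇒closed : IsCartier Q c → ∀ M → IsFacetLabeling Q M → IsClosedOn Q (λ a → M a ≡ -1ℚ) c
  cartier⇒closed cartier M facetM =
    let m , facet-m , m≗M = facetLabeling⇒facetFunctional Q sc facetM
    in potential⇒closed Q (potential-mono Q (λ {a} Ma≡-1 → trans (m≗M a) Ma≡-1)
                                           (character⇒potential Q (cartier m facet-m)))

  closed⇒cartier : (∀ M → IsFacetLabeling Q M → IsClosedOn Q (λ a → M a ≡ -1ℚ) c) → IsCartier Q c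
  closed⇒cartier closed m facet-m =
    potential⇒character Q (closed⇒potential Q (λ a → labelingOf Q m a ℚP.≟ -1ℚ)
                             (closed (labelingOf Q m) (facetFunctional⇒facetLabeling Q sc m facet-m)))
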